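{- Let $\mathbf v$ be a composition of operators with $S=\mathrm{supp}(\mathbf v)$ and $|S|=m$. Then $\mathbf v\equiv\mathbf 0$ if and only if $\underline{\mathbf v}\bullet_k u=0$ for all $u\in S_m$ and all $k\in[m-1]$.
   Context: For a positive integer $N$, $[N]=\{1,\dots,N\}$, $S_N$ is the symmetric group on $[N]$, $s_{ab}$ the transposition exchanging $a,b$, $\ell$ the number of inversions. With commuting indeterminates $q_1,\dots,q_{N-1}$, $\mathbf q^\alpha=\prod q_i^{\alpha_i}$, $\mathbf q_{ij}=q_i\cdots q_{j-1}$ ($i<j$), $S_N[\mathbf q]=\{\mathbf q^\alpha w\}$, $\ell(\mathbf q^\alpha w)=\ell(w)+2\deg\mathbf q^\alpha$. For $k\in[N-1]$ the quantum $k$-Bruhat order has covers, for $w\in S_N$ and $i\le k<j$: $w\lessdot_k ws_{ij}$ if $\ell(ws_{ij})=\ell(w)+1$, $w\lessdot_k\mathbf q_{ij}ws_{ij}$ if $\ell(\mathbf q_{ij}ws_{ij})=\ell(w)+1$; extended $\mathbf q$-multiplicatively. Operators $\mathbf v_{ab}$ ($a\neq b$ positive integers) generate a free monoid, with zero element $\mathbf 0$; a composition $\mathbf v_{a_rb_r}\cdots\mathbf v_{a_1b_1}$ has support $\{a_1,b_1,\dots,a_r,b_r\}$. For support in $[N]$, $k\in[N-1]$, $u\in S_N$: $\mathbf v_{ab}\bullet_ku=s_{ab}u$ if $a<b$ and $u\lessdot_ks_{ab}u$; $=\mathbf q_{ij}s_{ab}u$ if $a>b$, $i=u^{ -1}(a)$,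 $j=u^{ -1}(b)$ and $u\lessdot_k\mathbf q_{ij}s_{ab}u$; $=0$ otherwise; extended by $\mathbf v\bullet_k(\mathbf q^\alpha u)=\mathbf q^\alpha(\mathbf v\bullet_ku)$, $\bullet_k0=0$, compositions acting rightmost operator first. $\mathbf v\equiv\mathbf 0$ means $\mathbf v\bullet_kx=0$ for all $N$ with support in $[N]$, all $x\in S_N[\mathbf q]$, $k\in[N-1]$. Flattening: with $\phi_S:S\to[m]$ the order-preserving bijection, $\underline{\mathbf v}=\mathbf v_{\phi_S(a_r)\phi_S(b_r)}\cdots\mathbf v_{\phi_S(a_1)\phi_S(b_1)}$. -}

module Defs where

open import Data.Nat using (ℕ; zero; suc; _+_; _*_; _∸_; _≤_; _<_; _≟_; _≡ᵇ_; _<ᵇ_; _≤ᵇ_)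
open import Data.Bool using (Bool; true; false; _∧_; _∨_; if_then_else_)
open import Data.List using (List; []; _∷_; map; foldr; length; filterᵇ; applyUpTo; deduplicateᵇ; concatMap)
open import Data.Bool.ListAction using (any)
import Data.List.Properties as LP
import Data.Vec as V
open import Data.Vec using (Vec)
import Data.Vec.Properties as VP
open import Data.Fin using (Fin; toℕ)
open import Data.Maybe using (Maybe; just; nothing)
open import Data.Product using (_×_; _,_; proj₁; proj₂)
open import Relation.Nullary.Decidable using (⌊_⌋)
open import Data.List.Relation.Binary.Permutation.Propositional using (_↭_)
open import Data.List.Relation.Unary.All using (All)
open import Relation.Binary.PropositionalEquality using (_≡_; _≢_)

fromTo : ℕ → ℕ → List ℕ
fromTo a b = applyUpTo (λ t → a + t) (suc b ∸ a)

-- w(p) for a permutation in one-line notation, 1-based (0 if out of range)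
nth : List ℕ → ℕ → ℕ
nth [] _ = 0
nth (x ∷ xs) zero = 0
nth (x ∷ xs) (suc zero) = x
nth (x ∷ xs) (suc (suc p)) = nth xs (suc p)

-- u⁻¹(a): 1-based position of the value a (0 if absent)
pos : ℕ → List ℕ → ℕ
pos a [] = 0
pos a (x ∷ xs) = if x ≡ᵇ a then 1 else (if pos a xs ≡ᵇ 0 then 0 else suc (pos a xs))

-- Permutations of [N] in one-line notation  u = [u(1), ..., u(N)]

IsPerm : ℕ → List ℕ → Set
IsPerm N u = u ↭ fromTo 1 N

inv : List ℕ → ℕ
inv [] = 0
inv (x ∷ xs) = length (filterᵇ (λ y → y <ᵇ x) xs) + inv xs

-- left multiplication s_ab u : exchange the values a and b
swapVal : ℕ → ℕ → List ℕ → List ℕ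
swapVal a b = map (λ x → if x ≡ᵇ a then b else (if x ≡ᵇ b then a else x))

-- right multiplication w s_ij : exchange the entries in positions i and j
swapPos : ℕ → ℕ → List ℕ → List ℕ
swapPos i j w = map (λ p → nth w (if p ≡ᵇ i then j else (if p ≡ᵇ j then i else p))) (fromTo 1 (length w))

-- Monomials q^α in q_1,…,q_{N-1}: exponent vectors, entry t ↦ exponent of q_{t+1}

record Mon (N : ℕ) : Set where
  constructor mon
  field exps : Vec ℕ (N ∸ 1)
open Mon public

one : (N : ℕ) → Mon N
one N = mon (V.replicate (N ∸ 1) 0)

_·_ : {N : ℕ} → Mon N → Mon N → Mon N
mon α · mon β = mon (V.zipWith _+_ α β)

deg : {N : ℕ} → Mon N → ℕ
deg (mon α) = V.foldr _ _+_ 0 α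

qq : (N : ℕ) → ℕ → ℕ → Mon N
qq N i j = mon (V.tabulate (λ t → if (i ≤ᵇ suc (toℕ t)) ∧ (suc (toℕ t) <ᵇ j) then 1 else 0))

-- elements q^α w of S_N[q]
QPerm : ℕ → Set
QPerm N = Mon N × List ℕ

lenQ : {N : ℕ} → QPerm N → ℕ
lenQ (α , w) = inv w + 2 * deg α

eqQ : {N : ℕ} → QPerm N → QPerm N → Bool
eqQ (mon α , w) (mon β , w') = ⌊ VP.≡-dec _≟_ α β ⌋ ∧ ⌊ LP.≡-dec _≟_ w w' ⌋

coverᵇ : (N k : ℕ) → List ℕ → QPerm N → Bool
coverᵇ N k w y =
  any (λ i → any (λ j →
        (eqQ y (one N , swapPos i j w) ∧ (lenQ {N} (one N , swapPos i j w) ≡ᵇ suc (inv w)))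
      ∨ (eqQ y (qq N i j , swapPos i j w) ∧ (lenQ {N} (qq N i j , swapPos i j w) ≡ᵇ suc (inv w))))
    (fromTo (suc k) N)) (fromTo 1 k)

-- Operators.  A composition v_{a_r b_r} ⋯ v_{a_1 b_1} is the list
-- (a_r , b_r) ∷ … ∷ (a_1 , b_1) ∷ [] ; the rightmost operator acts first.

Word : Set
Word = List (ℕ × ℕ)

data ValidGen : ℕ × ℕ → Set where
  valid : ∀ {a b} → 1 ≤ a → 1 ≤ b → (a ≢ b) → ValidGen (a , b)

-- elements of S_N[q] ∪ {0}: nothing = 0
Elem : ℕ → Set
Elem N = Maybe (QPerm N)

actGenPerm : (N k a b : ℕ) → List ℕ → Elem N
actGenPerm N k a b u =
  if a <ᵇ b
  then (if coverᵇ N k u (one N , swapVal a b u) then just (one N , swapVal a b u) else nothing)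
  else (if b <ᵇ a
        then (if (pos a u <ᵇ pos b u) ∧ coverᵇ N k u (qq N (pos a u) (pos b u) , swapVal a b u)
              then just (qq N (pos a u) (pos b u) , swapVal a b u) else nothing)
        else nothing)

actGen : (N k : ℕ) → ℕ × ℕ → Elem N → Elem N
actGen N k (a , b) nothing = nothing
actGen N k (a , b) (just (α , u)) with actGenPerm N k a b u
... | nothing = nothing
... | just (β , w) = just (α · β , w)

act : (N k : ℕ) → Word → Elem N → Elem N
act N k v x = foldr (actGen N k) x v

supp : Word → List ℕ
supp = concatMap (λ p → proj₁ p ∷ proj₂ p ∷ [])

suppSet : Word → List ℕ
suppSet v = deduplicateᵇ _≡ᵇ_ (supp v)

-- φ_S(x) = 1 + #{s ∈ S | s < x}  (order-preserving bijection S → [|S|])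
φ : List ℕ → ℕ → ℕ
φ S x = suc (length (filterᵇ (λ s → s <ᵇ x) S))

flatten : Word → Word
flatten v = map (λ p → φ (suppSet v) (proj₁ p) , φ (suppSet v) (proj₂ p)) v

InRange : ℕ → ℕ → Set
InRange N x = (1 ≤ x) × (x ≤ N)

IsZeroOp : Word → Set
IsZeroOp v = (N : ℕ) → All (InRange N) (supp v) →
  (α : Mon N) (u : List ℕ) → IsPerm N u →
  (k : ℕ) → 1 ≤ k → k < N →
  act N k v (just (α , u)) ≡ nothing

module Submission where

open import Defs
open import Data.Nat using (ℕ; _≤_; _<_)
open import Data.List using (List; []; length)
open import Data.List.Relation.Unary.All using (All)
open import Data.Maybe using (just; nothing)
open import Data.Product using (_,_)
open import Relation.Binary.PropositionalEquality using (_≡_; _≢_)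
open import Function.Bundles using (_⇔_)

open import Data.Nat hiding (_≤_; _<_)
open import Data.Nat.Properties
open import Data.Nat.Tactic.RingSolver using (solve-∀)
open import Data.Bool using (Bool; true; false; _∧_; _∨_; not; if_then_else_; T; T?)
open import Data.Bool.Properties using (T-≡; ∨-zeroʳ)
open import Data.Unit using (tt)
open import Data.Empty using (⊥-elim)
open import Data.Sum using (_⊎_; inj₁; inj₂)
open import Data.Product using (_×_; proj₁; proj₂; ∃-syntax)
open import Data.Maybe.Properties using (just-injective)
import Data.Vec as V
import Data.Vec.Properties as VP
open import Data.List using (_∷_; map; filterᵇ; _++_; applyUpTo; take; deduplicateᵇ)
import Data.List.Properties as LP
open import Data.List.Properties
  using (length-++; length-map; length-applyUpTo; map-++; ++-assoc; ++-identityʳ; filter-++;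
         ∷-injectiveˡ; ∷-injectiveʳ; applyUpTo-∷ʳ; take++drop≡id)
open import Data.List.Extrema.Nat using (max; xs≤max)
open import Data.List.Relation.Unary.All using ([]; _∷_)
import Data.List.Relation.Unary.All as All
import Data.List.Relation.Unary.All.Properties as AllP
open import Data.List.Relation.Unary.Any using (here; there)
import Data.List.Relation.Unary.Any.Properties as AnyP
open import Data.List.Relation.Unary.AllPairs using ([]; _∷_)
open import Data.List.Relation.Unary.Unique.Propositional using (Unique)
import Data.List.Relation.Unary.Unique.Propositional.Properties as UniqueP
open import Data.List.Membership.Propositional using (_∈_)
open import Data.List.Membership.Propositional.Properties using (∈-filter⁺; ∈-filter⁻; ∈-applyUpTo⁺)
open import Data.List.Relation.Binary.Pointwise using (Pointwise; []; _∷_)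
import Data.List.Relation.Binary.Pointwise.Properties as PointwiseP
open import Data.List.Relation.Binary.Permutation.Propositional
  using (_↭_; ↭-refl; ↭-reflexive; ↭-sym; ↭-trans; prep; swap; ↭⇒↭ₛ)
import Data.List.Relation.Binary.Permutation.Propositional.Properties as PermP
open import Relation.Binary.PropositionalEquality
  using (refl; sym; trans; cong; cong₂; subst; subst₂; ≢-sym; module ≡-Reasoning)
  renaming (setoid to ≡-setoid)
open import Data.List.Relation.Binary.Permutation.Setoid.Properties (≡-setoid ℕ) using (Unique-resp-↭)
open import Relation.Binary.Definitions using (tri<; tri≈; tri>)
open import Relation.Nullary using (¬_; yes; no)
open import Function using (_∘_; id)
open import Function.Bundles using (mk⇔; Equivalence)
import Function.Properties.Equivalence as Eq

-- A generator v_ab acts nontrivially at level k on u ∈ S_N exactly when u = A a B b C with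
-- |A| < k ≤ |A| + |B| + 1 and either a < b and no entry of B lies between a and b (a Bruhat
-- cover), or b < a and every entry of B does (a quantum cover, with q-degree |B| + 1); the
-- result is A b B a C.  This follows from ℓ(A b B a C) = ℓ(A a B b C) + 1 + 2 #{c ∈ B : a < c < b}
-- for a < b.  The criterion only involves the relative order of a, b and the entries of B and
-- on which side of k they sit.  So deleting the values outside the support S and relabelling
-- order-preservingly turns a nonzero run of v at level k into a nonzero run of the flattened
-- word at level #{p ≤ k : u(p) ∈ S}; conversely, putting the values outside S first, in
-- increasing order, lifts a nonzero run of the flattened word on S_m to one of v on S_N.

<ᵇ≡true⇒< : ∀ {m n} → (m <ᵇ n) ≡ true → m < n
<ᵇ≡true⇒< {m} {n} e = <ᵇ⇒< m n (subst T (sym e) tt)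

<⇒<ᵇ≡true : ∀ {m n} → m < n → (m <ᵇ n) ≡ true
<⇒<ᵇ≡true {m} {n} m<n with m <ᵇ n | <⇒<ᵇ m<n
... | true | _ = refl

≥⇒<ᵇ≡false : ∀ {m n} → n ≤ m → (m <ᵇ n) ≡ false
≥⇒<ᵇ≡false {m} {n} n≤m with m <ᵇ n in e
... | true = ⊥-elim (<⇒≱ (<ᵇ≡true⇒< e) n≤m)
... | false = refl

≡ᵇ≡true⇒≡ : ∀ {m n} → (m ≡ᵇ n) ≡ true → m ≡ n
≡ᵇ≡true⇒≡ {m} {n} e = ≡ᵇ⇒≡ m n (subst T (sym e) tt)

≡⇒≡ᵇ≡true : ∀ {m n} → m ≡ n → (m ≡ᵇ n) ≡ true
≡⇒≡ᵇ≡true {m} {n} m≡n with m ≡ᵇ n | ≡⇒≡ᵇ m n m≡n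
... | true | _ = refl

≢⇒≡ᵇ≡false : ∀ {m n} → m ≢ n → (m ≡ᵇ n) ≡ false
≢⇒≡ᵇ≡false {m} {n} m≢n with m ≡ᵇ n in e
... | true = ⊥-elim (m≢n (≡ᵇ≡true⇒≡ e))
... | false = refl

∧≡true⇒× : ∀ {a b} → (a ∧ b) ≡ true → a ≡ true × b ≡ true
∧≡true⇒× {true} {true} _ = refl , refl

∨≡true⇒⊎ : ∀ {a b} → (a ∨ b) ≡ true → a ≡ true ⊎ b ≡ true
∨≡true⇒⊎ {true} _ = inj₁ refl
∨≡true⇒⊎ {false} e = inj₂ e

if-true : ∀ {X : Set} {c} {x y : X} → c ≡ true → (if c then x else y) ≡ x
if-true refl = refl

if-false : ∀ {X : Set} {c} {x y : X} → c ≡ false → (if c then x else y) ≡ y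
if-false refl = refl

just≢nothing : ∀ {A : Set} {x : A} → just x ≢ nothing
just≢nothing ()

count : (ℕ → Bool) → List ℕ → ℕ
count p xs = length (filterᵇ p xs)

indicator : Bool → ℕ
indicator true = 1
indicator false = 0

count-∷ : ∀ p x xs → count p (x ∷ xs) ≡ indicator (p x) + count p xs
count-∷ p x xs with p x
... | true = refl
... | false = refl

count-++ : ∀ p xs ys → count p (xs ++ ys) ≡ count p xs + count p ys
count-++ p xs ys = trans (cong length (filter-++ (T? ∘ p) xs ys)) (length-++ (filterᵇ p xs))

count-take≤ : ∀ p xs q → count p (take q xs) ≤ count p xs
count-take≤ p xs q = subst (count p (take q xs) ≤_)
  (trans (sym (count-++ p (take q xs) _)) (cong (count p) (take++drop≡id q xs))) (m≤m+n _ _)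

count≡0⇒All-false : ∀ p xs → count p xs ≡ 0 → All (λ x → p x ≡ false) xs
count≡0⇒All-false p [] _ = []
count≡0⇒All-false p (x ∷ xs) e with p x in px
... | false = px ∷ count≡0⇒All-false p xs e

All-false⇒count≡0 : ∀ p xs → All (λ x → p x ≡ false) xs → count p xs ≡ 0
All-false⇒count≡0 p [] [] = refl
All-false⇒count≡0 p (x ∷ xs) (px ∷ pxs) rewrite px = All-false⇒count≡0 p xs pxs

count≤length : ∀ p xs → count p xs ≤ length xs
count≤length p [] = z≤n
count≤length p (x ∷ xs) with p x
... | true = s≤s (count≤length p xs)
... | false = m≤n⇒m≤1+n (count≤length p xs)

count≡length⇒All-true : ∀ p xs → count p xs ≡ length xs → All (λ x → p x ≡ true) xs
count≡length⇒All-true p [] _ = []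
count≡length⇒All-true p (x ∷ xs) e with p x in px
... | true = px ∷ count≡length⇒All-true p xs (suc-injective e)
... | false = ⊥-elim (1+n≰n (subst (_≤ length xs) e (count≤length p xs)))

All-true⇒count≡length : ∀ p xs → All (λ x → p x ≡ true) xs → count p xs ≡ length xs
All-true⇒count≡length p [] [] = refl
All-true⇒count≡length p (x ∷ xs) (px ∷ pxs) rewrite px = cong suc (All-true⇒count≡length p xs pxs)

count-mono : ∀ p q xs → (∀ c → p c ≡ true → q c ≡ true) → count p xs ≤ count q xs
count-mono p q [] _ = z≤n
count-mono p q (x ∷ xs) p⇒q rewrite count-∷ p x xs | count-∷ q x xs with p x in px
... | true rewrite p⇒q x px = s≤s (count-mono p q xs p⇒q)
... | false = ≤-trans (count-mono p q xs p⇒q) (m≤n+m _ (indicator (q x)))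

count-mono-< : ∀ p q xs c → (∀ c → p c ≡ true → q c ≡ true) → c ∈ xs → p c ≡ false → q c ≡ true →
  count p xs < count q xs
count-mono-< p q (x ∷ xs) c p⇒q (here refl) pc qc rewrite count-∷ p x xs | count-∷ q x xs | pc | qc =
  s≤s (count-mono p q xs p⇒q)
count-mono-< p q (x ∷ xs) c p⇒q (there c∈xs) pc qc rewrite count-∷ p x xs | count-∷ q x xs with p x in px
... | true rewrite p⇒q x px = s≤s (count-mono-< p q xs c p⇒q c∈xs pc qc)
... | false = ≤-trans (count-mono-< p q xs c p⇒q c∈xs pc qc) (m≤n+m _ (indicator (q x)))

countLess : ℕ → List ℕ → ℕ
countLess x = count (_<ᵇ x)

countGreater : ℕ → List ℕ → ℕ
countGreater x = count (x <ᵇ_)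

countBetween : ℕ → ℕ → List ℕ → ℕ
countBetween x y = count (λ c → (x <ᵇ c) ∧ (c <ᵇ y))

Avoids : ℕ → ℕ → List ℕ → Set
Avoids x y = All (λ c → c ≢ x × c ≢ y)

Avoids-comm : ∀ {x y zs} → Avoids x y zs → Avoids y x zs
Avoids-comm = All.map (λ (c≢x , c≢y) → c≢y , c≢x)

inv-insert : ∀ xs y zs → inv (xs ++ y ∷ zs) ≡ inv (xs ++ zs) + countGreater y xs + countLess y zs
inv-insert [] y zs =
  trans (+-comm (countLess y zs) (inv zs)) (cong (_+ countLess y zs) (sym (+-identityʳ (inv zs))))
inv-insert (x ∷ xs) y zs
  rewrite count-++ (_<ᵇ x) xs (y ∷ zs) | count-∷ (_<ᵇ x) y zs | count-++ (_<ᵇ x) xs zs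
        | inv-insert xs y zs | count-∷ (y <ᵇ_) x xs
  = regroup (countLess x xs) (indicator (y <ᵇ x)) (countLess x zs) (inv (xs ++ zs))
            (countGreater y xs) (countLess y zs)
  where
  regroup : ∀ a i c r g l → a + (i + c) + (r + g + l) ≡ a + c + r + (i + g) + l
  regroup = solve-∀

-- Each entry c of xs contributes [c < y] + [x < c] = [c < x] + [y < c] + 2 [x < c < y].
countLess-countGreater-balance : ∀ x y xs → x < y → Avoids x y xs →
  countLess y xs + countGreater x xs ≡ countLess x xs + countGreater y xs + 2 * countBetween x y xs
countLess-countGreater-balance x y [] _ [] = refl
countLess-countGreater-balance x y (c ∷ xs) x<y ((c≢x , c≢y) ∷ avoids)
  rewrite count-∷ (_<ᵇ y) c xs | count-∷ (x <ᵇ_) c xs | count-∷ (_<ᵇ x) c xs | count-∷ (y <ᵇ_) c xs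
        | count-∷ (λ c → (x <ᵇ c) ∧ (c <ᵇ y)) c xs
  = add-balances (indicator (c <ᵇ y)) (indicator (x <ᵇ c)) (indicator (c <ᵇ x)) (indicator (y <ᵇ c))
      (indicator ((x <ᵇ c) ∧ (c <ᵇ y))) (countLess y xs) (countGreater x xs) (countLess x xs) (countGreater y xs)
      (countBetween x y xs) head (countLess-countGreater-balance x y xs x<y avoids)
  where
  head : indicator (c <ᵇ y) + indicator (x <ᵇ c)
       ≡ indicator (c <ᵇ x) + indicator (y <ᵇ c) + 2 * indicator ((x <ᵇ c) ∧ (c <ᵇ y))
  head with <-cmp c x
  ... | tri≈ _ c≡x _ = ⊥-elim (c≢x c≡x)
  ... | tri< c<x _ _ rewrite <⇒<ᵇ≡true c<x | <⇒<ᵇ≡true (<-trans c<x x<y)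
                           | ≥⇒<ᵇ≡false (<⇒≤ c<x) | ≥⇒<ᵇ≡false (<⇒≤ (<-trans c<x x<y)) = refl
  ... | tri> _ _ x<c with <-cmp c y
  ... | tri≈ _ c≡y _ = ⊥-elim (c≢y c≡y)
  ... | tri< c<y _ _ rewrite <⇒<ᵇ≡true c<y | <⇒<ᵇ≡true x<c
                           | ≥⇒<ᵇ≡false (<⇒≤ x<c) | ≥⇒<ᵇ≡false (<⇒≤ c<y) = refl
  ... | tri> _ _ y<c rewrite <⇒<ᵇ≡true y<c | <⇒<ᵇ≡true x<c
                           | ≥⇒<ᵇ≡false (<⇒≤ x<c) | ≥⇒<ᵇ≡false (<⇒≤ y<c) = refl
  add-balances : ∀ p q r s t a c d e f → p + q ≡ r + s + 2 * t → a + c ≡ d + e + 2 * f →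
    p + a + (q + c) ≡ r + d + (s + e) + 2 * (t + f)
  add-balances p q r s t a c d e f h₁ h₂ =
    trans (regroupˡ p q a c) (trans (cong₂ _+_ h₁ h₂) (regroupʳ r s t d e f))
    where
    regroupˡ : ∀ p q a c → p + a + (q + c) ≡ (p + q) + (a + c)
    regroupˡ = solve-∀
    regroupʳ : ∀ r s t d e f → (r + s + 2 * t) + (d + e + 2 * f) ≡ r + d + (s + e) + 2 * (t + f)
    regroupʳ = solve-∀

inv-transpose-head : ∀ x y xs zs → x < y → Avoids x y xs →
  inv (y ∷ xs ++ x ∷ zs) ≡ inv (x ∷ xs ++ y ∷ zs) + (1 + 2 * countBetween x y xs)
inv-transpose-head x y xs zs x<y avoids
  rewrite count-++ (_<ᵇ y) xs (x ∷ zs) | count-∷ (_<ᵇ y) x zs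
        | count-++ (_<ᵇ x) xs (y ∷ zs) | count-∷ (_<ᵇ x) y zs
        | inv-insert xs x zs | inv-insert xs y zs | <⇒<ᵇ≡true x<y | ≥⇒<ᵇ≡false (<⇒≤ x<y)
  = trans (regroupˡ (countLess y xs) (countGreater x xs) (countLess y zs) (inv (xs ++ zs)) (countLess x zs))
      (trans (cong (λ s → s + countLess y zs + inv (xs ++ zs) + countLess x zs + 1)
                   (countLess-countGreater-balance x y xs x<y avoids))
        (regroupʳ (countLess x xs) (countGreater y xs) (countBetween x y xs)
                  (countLess y zs) (countLess x zs) (inv (xs ++ zs))))
  where
  regroupˡ : ∀ a c l₁ r l₂ → a + (1 + l₁) + (r + c + l₂) ≡ (a + c) + l₁ + r + l₂ + 1
  regroupˡ = solve-∀
  regroupʳ : ∀ d e f l₁ l₂ r → (d + e + 2 * f) + l₁ + r + l₂ + 1 ≡ d + (0 + l₂) + (r + e + l₁) + (1 + 2 * f)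
  regroupʳ = solve-∀

countLess-transpose : ∀ a x y xs zs → countLess a (x ∷ xs ++ y ∷ zs) ≡ countLess a (y ∷ xs ++ x ∷ zs)
countLess-transpose a x y xs zs
  rewrite count-∷ (_<ᵇ a) x (xs ++ y ∷ zs) | count-∷ (_<ᵇ a) y (xs ++ x ∷ zs)
        | count-++ (_<ᵇ a) xs (y ∷ zs) | count-++ (_<ᵇ a) xs (x ∷ zs)
        | count-∷ (_<ᵇ a) y zs | count-∷ (_<ᵇ a) x zs
  = exchange (indicator (x <ᵇ a)) (indicator (y <ᵇ a)) (countLess a xs) (countLess a zs)
  where
  exchange : ∀ p q r s → p + (r + (q + s)) ≡ q + (r + (p + s))
  exchange = solve-∀

inv-++ˡ : ∀ ws ys zs d → (∀ a → countLess a ys ≡ countLess a zs) →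
  inv zs ≡ inv ys + d → inv (ws ++ zs) ≡ inv (ws ++ ys) + d
inv-++ˡ [] ys zs d _ e = e
inv-++ˡ (w ∷ ws) ys zs d same e
  rewrite count-++ (_<ᵇ w) ws zs | count-++ (_<ᵇ w) ws ys | same w | inv-++ˡ ws ys zs d same e
  = sym (+-assoc (countLess w ws + countLess w zs) (inv (ws ++ ys)) d)

inv-transpose : ∀ ws x xs y zs → x < y → Avoids x y xs →
  inv (ws ++ y ∷ xs ++ x ∷ zs) ≡ inv (ws ++ x ∷ xs ++ y ∷ zs) + (1 + 2 * countBetween x y xs)
inv-transpose ws x xs y zs x<y avoids =
  inv-++ˡ ws (x ∷ xs ++ y ∷ zs) (y ∷ xs ++ x ∷ zs) _ (λ a → countLess-transpose a x y xs zs)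
    (inv-transpose-head x y xs zs x<y avoids)

swapValue : ℕ → ℕ → ℕ → ℕ
swapValue a b c = if c ≡ᵇ a then b else (if c ≡ᵇ b then a else c)

nth-applyUpTo : ∀ f n t → t < n → nth (applyUpTo f n) (suc t) ≡ f t
nth-applyUpTo f (suc n) zero _ = refl
nth-applyUpTo f (suc n) (suc t) (s≤s t<n) = nth-applyUpTo (f ∘ suc) n t t<n

nth-map : ∀ f xs t → t < length xs → nth (map f xs) (suc t) ≡ f (nth xs (suc t))
nth-map f (x ∷ xs) zero _ = refl
nth-map f (x ∷ xs) (suc t) (s≤s t<n) = nth-map f xs t t<n

nth-map-applyUpTo : ∀ g f n t → t < n → nth (map g (applyUpTo f n)) (suc t) ≡ g (f t)
nth-map-applyUpTo g f n t t<n =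
  trans (nth-map g (applyUpTo f n) t (subst (t <_) (sym (length-applyUpTo f n)) t<n))
        (cong g (nth-applyUpTo f n t t<n))

nth-extensionality : ∀ xs ys → length xs ≡ length ys →
  (∀ t → t < length xs → nth xs (suc t) ≡ nth ys (suc t)) → xs ≡ ys
nth-extensionality [] [] _ _ = refl
nth-extensionality (x ∷ xs) (y ∷ ys) e h =
  cong₂ _∷_ (h 0 z<s) (nth-extensionality xs ys (suc-injective e) (λ t t<n → h (suc t) (s<s t<n)))

nth-∈ : ∀ xs t → t < length xs → nth xs (suc t) ∈ xs
nth-∈ (x ∷ xs) zero _ = here refl
nth-∈ (x ∷ xs) (suc t) (s≤s t<n) = there (nth-∈ xs t t<n)

∈⇒nth : ∀ xs {x} → x ∈ xs → ∃[ t ] (t < length xs × nth xs (suc t) ≡ x)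
∈⇒nth (y ∷ xs) (here refl) = 0 , z<s , refl
∈⇒nth (y ∷ xs) (there x∈xs) with ∈⇒nth xs x∈xs
... | t , t<n , e = suc t , s<s t<n , e

map-nth-fromTo : ∀ xs → map (nth xs) (fromTo 1 (length xs)) ≡ xs
map-nth-fromTo xs = nth-extensionality _ _ same-length
  (λ t t<n → nth-map-applyUpTo (nth xs) (1 +_) (length xs) t (subst (t <_) same-length t<n))
  where
  same-length : length (map (nth xs) (fromTo 1 (length xs))) ≡ length xs
  same-length = trans (length-map _ (fromTo 1 (length xs))) (length-applyUpTo (1 +_) (length xs))

nth-at : ∀ xs x ys → nth (xs ++ x ∷ ys) (suc (length xs)) ≡ x
nth-at [] x ys = refl
nth-at (z ∷ xs) x ys = nth-at xs x ys

nth-away : ∀ xs x x′ ys p → p ≢ suc (length xs) → nth (xs ++ x ∷ ys) p ≡ nth (xs ++ x′ ∷ ys) p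
nth-away [] x x′ ys zero _ = refl
nth-away [] x x′ ys (suc zero) p≢1 = ⊥-elim (p≢1 refl)
nth-away [] x x′ ys (suc (suc p)) _ = refl
nth-away (z ∷ xs) x x′ ys zero _ = refl
nth-away (z ∷ xs) x x′ ys (suc zero) _ = refl
nth-away (z ∷ xs) x x′ ys (suc (suc p)) p≢ = nth-away xs x x′ ys (suc p) (p≢ ∘ cong suc)

length-transposed : ∀ (A : List ℕ) x B y C →
  length (A ++ x ∷ B ++ y ∷ C) ≡ length A + suc (length B + suc (length C))
length-transposed A x B y C rewrite length-++ A {x ∷ B ++ y ∷ C} | length-++ B {y ∷ C} = refl

-- Throughout, x and y sit at the 1-based positions i = |A| + 1 and j = |A| + |B| + 2 of A ++ x ∷ B ++ y ∷ C.
nth-at₂ : ∀ A x B y C → nth (A ++ x ∷ B ++ y ∷ C) (suc (length A + suc (length B))) ≡ y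
nth-at₂ A x B y C rewrite sym (++-assoc A (x ∷ B) (y ∷ C)) | sym (length-++ A {x ∷ B}) =
  nth-at (A ++ x ∷ B) y C

nth-away₂ : ∀ A x B y y′ C p → p ≢ suc (length A + suc (length B)) →
  nth (A ++ x ∷ B ++ y ∷ C) p ≡ nth (A ++ x ∷ B ++ y′ ∷ C) p
nth-away₂ A x B y y′ C p p≢j
  rewrite sym (++-assoc A (x ∷ B) (y ∷ C)) | sym (++-assoc A (x ∷ B) (y′ ∷ C))
  = nth-away (A ++ x ∷ B) y y′ C p (subst (λ n → p ≢ suc n) (sym (length-++ A {x ∷ B})) p≢j)

i<j : ∀ a b → suc a < suc (a + suc b)
i<j a b = s<s (m<m+n a z<s)

j≤length : ∀ (A : List ℕ) x B y C → suc (length A + suc (length B)) ≤ length (A ++ x ∷ B ++ y ∷ C)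
j≤length A x B y C rewrite length-transposed A x B y C =
  subst (_≤ length A + suc (length B + suc (length C))) (+-suc (length A) (suc (length B)))
    (+-monoʳ-≤ (length A) (s≤s (m<m+n (length B) z<s)))

length-swapPos : ∀ i j w → length (swapPos i j w) ≡ length w
length-swapPos i j w = trans (length-map _ (fromTo 1 (length w))) (length-applyUpTo (1 +_) (length w))

swapPos-transposed : ∀ A x B y C →
  swapPos (suc (length A)) (suc (length A + suc (length B))) (A ++ x ∷ B ++ y ∷ C) ≡ A ++ y ∷ B ++ x ∷ C
swapPos-transposed A x B y C =
  nth-extensionality _ _ same-length
    (λ t t<n → trans (nth-map-applyUpTo _ (1 +_) (length u) t (subst (t <_) (length-swapPos i j u) t<n))
                     (pointwise (suc t)))
  where
  u = A ++ x ∷ B ++ y ∷ C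
  w = A ++ y ∷ B ++ x ∷ C
  i = suc (length A)
  j = suc (length A + suc (length B))
  same-length : length (swapPos i j u) ≡ length w
  same-length =
    trans (length-swapPos i j u) (trans (length-transposed A x B y C) (sym (length-transposed A y B x C)))
  pointwise : ∀ p → nth u (swapValue i j p) ≡ nth w p
  pointwise p with p ≟ i
  ... | yes refl rewrite ≡⇒≡ᵇ≡true {p} refl = trans (nth-at₂ A x B y C) (sym (nth-at A y (B ++ x ∷ C)))
  ... | no p≢i with p ≟ j
  ...   | yes refl rewrite ≢⇒≡ᵇ≡false p≢i | ≡⇒≡ᵇ≡true {p} refl =
    trans (nth-at A x (B ++ y ∷ C)) (sym (nth-at₂ A y B x C))
  ...   | no p≢j rewrite ≢⇒≡ᵇ≡false p≢i | ≢⇒≡ᵇ≡false p≢j =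
    trans (nth-away A x y (B ++ y ∷ C) p p≢i) (nth-away₂ A y B y x C p p≢j)

splitAt-position : ∀ (xs : List ℕ) t → t < length xs →
  ∃[ A ] ∃[ z ] ∃[ R ] (xs ≡ A ++ z ∷ R × length A ≡ t)
splitAt-position (z ∷ R) zero _ = [] , z , R , refl , refl
splitAt-position (x ∷ xs) (suc t) (s≤s t<n) with splitAt-position xs t t<n
... | A , z , R , refl , refl = x ∷ A , z , R , refl , refl

splitAt-positions : ∀ (xs : List ℕ) s r → suc (s + suc r) ≤ length xs →
  ∃[ A ] ∃[ x ] ∃[ B ] ∃[ y ] ∃[ C ] (xs ≡ A ++ x ∷ B ++ y ∷ C × length A ≡ s × length B ≡ r)
splitAt-positions xs s r j≤n with splitAt-position xs s (≤-trans (s≤s (m≤m+n s (suc r))) j≤n)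
... | A , x , R , refl , refl with splitAt-position R r r<length-R
  where
  r<length-R : r < length R
  r<length-R = s≤s⁻¹ (+-cancelˡ-≤ (length A) (suc (suc r)) (suc (length R))
    (subst₂ _≤_ (sym (+-suc (length A) (suc r))) (length-++ A {x ∷ R}) j≤n))
... | B , y , C , refl , refl = A , x , B , y , C , refl , refl , refl

record DistinctEntries (A : List ℕ) (x : ℕ) (B : List ℕ) (y : ℕ) (C : List ℕ) : Set where
  constructor distinctEntries
  field
    x≢y : x ≢ y
    avoidsA : Avoids x y A
    avoidsB : Avoids x y B
    avoidsC : Avoids x y C

transposed↭ : ∀ (A : List ℕ) x B y C → A ++ x ∷ B ++ y ∷ C ↭ x ∷ y ∷ A ++ B ++ C
transposed↭ A x B y C = ↭-trans (PermP.shift x A (B ++ y ∷ C))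
  (prep x (subst₂ _↭_ (++-assoc A B (y ∷ C)) (cong (y ∷_) (++-assoc A B C)) (PermP.shift y (A ++ B) C)))

transpose↭ : ∀ (A : List ℕ) a B b C → A ++ a ∷ B ++ b ∷ C ↭ A ++ b ∷ B ++ a ∷ C
transpose↭ A a B b C =
  ↭-trans (transposed↭ A a B b C) (↭-trans (swap a b ↭-refl) (↭-sym (transposed↭ A b B a C)))

unique⇒distinctEntries : ∀ A x B y C → Unique (A ++ x ∷ B ++ y ∷ C) → DistinctEntries A x B y C
unique⇒distinctEntries A x B y C u with Unique-resp-↭ (↭⇒↭ₛ (transposed↭ A x B y C)) u
... | (x≢y ∷ x≢rest) ∷ y≢rest ∷ _ =
  distinctEntries x≢y (proj₁ avoidsA,BC) (proj₁ avoidsB,C) (proj₂ avoidsB,C)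
  where
  avoids : Avoids x y (A ++ B ++ C)
  avoids = All.zipWith (λ (x≢c , y≢c) → ≢-sym x≢c , ≢-sym y≢c) (x≢rest , y≢rest)
  avoidsA,BC = AllP.++⁻ A avoids
  avoidsB,C = AllP.++⁻ B (proj₂ avoidsA,BC)

swapVal-avoiding : ∀ a b xs → Avoids a b xs → swapVal a b xs ≡ xs
swapVal-avoiding a b [] [] = refl
swapVal-avoiding a b (c ∷ xs) ((c≢a , c≢b) ∷ avoids)
  rewrite ≢⇒≡ᵇ≡false c≢a | ≢⇒≡ᵇ≡false c≢b = cong (c ∷_) (swapVal-avoiding a b xs avoids)

swapVal-transposed : ∀ A a B b C → DistinctEntries A a B b C →
  swapVal a b (A ++ a ∷ B ++ b ∷ C) ≡ A ++ b ∷ B ++ a ∷ C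
swapVal-transposed A a B b C (distinctEntries a≢b avoidsA avoidsB avoidsC)
  rewrite map-++ (swapValue a b) A (a ∷ B ++ b ∷ C) | map-++ (swapValue a b) B (b ∷ C)
        | swapVal-avoiding a b A avoidsA | swapVal-avoiding a b B avoidsB | swapVal-avoiding a b C avoidsC
        | ≡⇒≡ᵇ≡true {a} refl | ≢⇒≡ᵇ≡false (≢-sym a≢b) | ≡⇒≡ᵇ≡true {b} refl
  = refl

∷-injectiveˡ-at : ∀ (xs ys zs ws : List ℕ) {x y} → length xs ≡ length ys →
  xs ++ x ∷ zs ≡ ys ++ y ∷ ws → x ≡ y
∷-injectiveˡ-at [] [] zs ws _ e = ∷-injectiveˡ e
∷-injectiveˡ-at (_ ∷ xs) (_ ∷ ys) zs ws l e = ∷-injectiveˡ-at xs ys zs ws (suc-injective l) (∷-injectiveʳ e)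

swapVal≡transposed⇒ends : ∀ a b A x B y C → x ≢ y →
  swapVal a b (A ++ x ∷ B ++ y ∷ C) ≡ A ++ y ∷ B ++ x ∷ C → (x ≡ a × y ≡ b) ⊎ (x ≡ b × y ≡ a)
swapVal≡transposed⇒ends a b A x B y C x≢y e =
  ends (∷-injectiveˡ-at (map (swapValue a b) A) A _ _ (length-map (swapValue a b) A)
         (trans (sym (map-++ (swapValue a b) A (x ∷ B ++ y ∷ C))) e))
  where
  ends : swapValue a b x ≡ y → (x ≡ a × y ≡ b) ⊎ (x ≡ b × y ≡ a)
  ends h with x ≡ᵇ a in x≡a
  ... | true = inj₁ (≡ᵇ≡true⇒≡ x≡a , sym h)
  ... | false with x ≡ᵇ b in x≡b
  ...   | true = inj₂ (≡ᵇ≡true⇒≡ x≡b , sym h)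
  ...   | false = ⊥-elim (x≢y h)

pos-at : ∀ a A R → All (_≢ a) A → pos a (A ++ a ∷ R) ≡ suc (length A)
pos-at a [] R [] rewrite ≡⇒≡ᵇ≡true {a} refl = refl
pos-at a (c ∷ A) R (c≢a ∷ A≢a) rewrite ≢⇒≡ᵇ≡false c≢a | pos-at a A R A≢a = refl

pos-first : ∀ A x B y C → DistinctEntries A x B y C → pos x (A ++ x ∷ B ++ y ∷ C) ≡ suc (length A)
pos-first A x B y C d = pos-at x A _ (All.map proj₁ (DistinctEntries.avoidsA d))

pos-second : ∀ A x B y C → DistinctEntries A x B y C →
  pos y (A ++ x ∷ B ++ y ∷ C) ≡ suc (length A + suc (length B))
pos-second A x B y C d =
  trans (cong (pos y) (sym (++-assoc A (x ∷ B) (y ∷ C))))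
    (trans (pos-at y (A ++ x ∷ B) C (AllP.++⁺ (All.map proj₂ avoidsA) (x≢y ∷ All.map proj₂ avoidsB)))
      (cong suc (length-++ A)))
  where open DistinctEntries d

deg-one : ∀ N → deg (one N) ≡ 0
deg-one N = sum-zeros (N ∸ 1)
  where
  sum-zeros : ∀ n → V.foldr _ _+_ 0 (V.replicate n 0) ≡ 0
  sum-zeros zero = refl
  sum-zeros (suc n) = sum-zeros n

-- These recursions rely on deg (qq (2 + n) (1 + i) (1 + j)) reducing to deg (qq (1 + n) i j) when i ≥ 1.
deg-qq₁ : ∀ n j → j ≤ suc n → deg (qq (suc n) 1 j) ≡ pred j
deg-qq₁ zero zero _ = refl
deg-qq₁ zero (suc zero) _ = refl
deg-qq₁ zero (suc (suc j)) (s≤s ())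
deg-qq₁ (suc n) zero _ = deg-qq₁ n zero z≤n
deg-qq₁ (suc n) (suc zero) _ = deg-qq₁ n zero z≤n
deg-qq₁ (suc n) (suc (suc j)) (s≤s j≤n) = cong suc (deg-qq₁ n (suc j) j≤n)

deg-qq : ∀ N i j → 1 ≤ i → i ≤ j → j ≤ N → deg (qq N i j) ≡ j ∸ i
deg-qq zero (suc i) (suc j) _ _ ()
deg-qq (suc n) (suc zero) j _ _ j≤N = deg-qq₁ n j j≤N
deg-qq (suc n) (suc (suc i)) (suc zero) _ (s≤s ()) _
deg-qq (suc zero) (suc (suc i)) (suc (suc j)) _ _ (s≤s ())
deg-qq (suc (suc n)) (suc (suc i)) (suc (suc j)) _ (s≤s i≤j) (s≤s j≤N) =
  deg-qq (suc n) (suc i) (suc j) (s≤s z≤n) i≤j j≤N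

deg-qq-transposition : ∀ N (A B : List ℕ) → suc (length A + suc (length B)) ≤ N →
  deg (qq N (suc (length A)) (suc (length A + suc (length B)))) ≡ suc (length B)
deg-qq-transposition N A B j≤N =
  trans (deg-qq N _ _ (s≤s z≤n) (<⇒≤ (i<j (length A) (length B))) j≤N) (m+n∸m≡n (length A) (suc (length B)))

qq-transposition≢one : ∀ N (A B : List ℕ) → suc (length A + suc (length B)) ≤ N →
  qq N (suc (length A)) (suc (length A + suc (length B))) ≢ one N
qq-transposition≢one N A B j≤N e =
  0≢1+n (trans (sym (deg-one N)) (trans (cong deg (sym e)) (deg-qq-transposition N A B j≤N)))

eqQ≡true⇒≡ : ∀ {N} (y z : QPerm N) → eqQ y z ≡ true → y ≡ z
eqQ≡true⇒≡ (mon α , w) (mon β , w′) e with VP.≡-dec _≟_ α β | LP.≡-dec _≟_ w w′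
... | yes refl | yes refl = refl
eqQ≡true⇒≡ (mon α , w) (mon β , w′) () | yes _ | no _
eqQ≡true⇒≡ (mon α , w) (mon β , w′) () | no _ | _

eqQ-refl : ∀ {N} (y : QPerm N) → eqQ y y ≡ true
eqQ-refl (mon α , w) with VP.≡-dec _≟_ α α | LP.≡-dec _≟_ w w
... | yes _ | yes _ = refl
... | no α≢α | _ = ⊥-elim (α≢α refl)
... | yes _ | no w≢w = ⊥-elim (w≢w refl)

-- The disjunct of coverᵇ N k w y at the pair (i , j); k only bounds the range of the pairs.
coverAtᵇ : (N : ℕ) → List ℕ → QPerm N → ℕ → ℕ → Bool
coverAtᵇ N w y i j =
    (eqQ y (one N , swapPos i j w) ∧ (lenQ {N} (one N , swapPos i j w) ≡ᵇ suc (inv w)))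
  ∨ (eqQ y (qq N i j , swapPos i j w) ∧ (lenQ {N} (qq N i j , swapPos i j w) ≡ᵇ suc (inv w)))

m<n∸o⇒o+m<n : ∀ o n {m} → m < n ∸ o → o + m < n
m<n∸o⇒o+m<n zero n m<n = m<n
m<n∸o⇒o+m<n (suc o) (suc n) m<n∸o = s<s (m<n∸o⇒o+m<n o n m<n∸o)

coverᵇ≡true⇒coverAtᵇ : ∀ N k w y → coverᵇ N k w y ≡ true →
  ∃[ i ] ∃[ j ] (1 ≤ i × i ≤ k × k < j × j ≤ N × coverAtᵇ N w y i j ≡ true)
coverᵇ≡true⇒coverAtᵇ N k w y c with AnyP.applyUpTo⁻ (1 +_) (AnyP.any⁻ _ _ (Equivalence.from T-≡ c))
... | t , t<k , inner with AnyP.applyUpTo⁻ (suc k +_) (AnyP.any⁻ _ _ inner)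
... | s , s<N∸k , at =
  suc t , suc k + s , s≤s z≤n , t<k , s≤s (m≤m+n k s) , m<n∸o⇒o+m<n k N s<N∸k , Equivalence.to T-≡ at

coverAtᵇ⇒coverᵇ≡true : ∀ N k w y i j → 1 ≤ i → i ≤ k → k < j → j ≤ N →
  coverAtᵇ N w y i j ≡ true → coverᵇ N k w y ≡ true
coverAtᵇ⇒coverᵇ≡true N k w y (suc t) j _ i≤k k<j j≤N at with m≤n⇒∃[o]m+o≡n k<j
... | d , refl = Equivalence.to T-≡ (AnyP.any⁺ _ (AnyP.applyUpTo⁺ (1 +_) (AnyP.any⁺ _ inner) i≤k))
  where
  d<N∸k : d < N ∸ k
  d<N∸k = m+n≤o⇒m≤o∸n (suc d) (subst (_≤ N) (cong suc (+-comm k d)) j≤N)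
  inner = AnyP.applyUpTo⁺ (suc k +_) (Equivalence.from T-≡ at) d<N∸k

data CoverKind (N : ℕ) (u : List ℕ) (y : QPerm N) (A B : List ℕ) (w : List ℕ) : Set where
  classical : y ≡ (one N , w) → inv w ≡ suc (inv u) → CoverKind N u y A B w
  quantum : y ≡ (qq N (suc (length A)) (suc (length A + suc (length B))) , w) →
    inv w + 2 * suc (length B) ≡ suc (inv u) → CoverKind N u y A B w

record Cover (N k : ℕ) (u : List ℕ) (y : QPerm N) : Set where
  constructor cover
  field
    A B C : List ℕ
    x z : ℕ
    source : u ≡ A ++ x ∷ B ++ z ∷ C
    i≤k : suc (length A) ≤ k
    k<j : k < suc (length A + suc (length B))
    kind : CoverKind N u y A B (A ++ z ∷ B ++ x ∷ C)

CoverKind-target : ∀ {N u y A B w} → CoverKind N u y A B w → proj₂ y ≡ w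
CoverKind-target (classical refl _) = refl
CoverKind-target (quantum refl _) = refl

coverAtᵇ⇒CoverKind : ∀ N A x B z C y → suc (length A + suc (length B)) ≤ N →
  coverAtᵇ N (A ++ x ∷ B ++ z ∷ C) y (suc (length A)) (suc (length A + suc (length B))) ≡ true →
  CoverKind N (A ++ x ∷ B ++ z ∷ C) y A B (A ++ z ∷ B ++ x ∷ C)
coverAtᵇ⇒CoverKind N A x B z C y j≤N at rewrite swapPos-transposed A x B z C with ∨≡true⇒⊎ at
... | inj₁ classical-at =
  let (y≡ , len) = ∧≡true⇒× classical-at
  in classical (eqQ≡true⇒≡ _ _ y≡)
       (trans (sym (trans (cong (λ d → inv w + 2 * d) (deg-one N)) (+-identityʳ _))) (≡ᵇ≡true⇒≡ len))
  where w = A ++ z ∷ B ++ x ∷ C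
... | inj₂ quantum-at =
  let (y≡ , len) = ∧≡true⇒× quantum-at
  in quantum (eqQ≡true⇒≡ _ _ y≡)
       (trans (cong (λ d → inv w + 2 * d) (sym (deg-qq-transposition N A B j≤N))) (≡ᵇ≡true⇒≡ len))
  where w = A ++ z ∷ B ++ x ∷ C

CoverKind⇒coverAtᵇ : ∀ N A x B z C y → suc (length A + suc (length B)) ≤ N →
  CoverKind N (A ++ x ∷ B ++ z ∷ C) y A B (A ++ z ∷ B ++ x ∷ C) →
  coverAtᵇ N (A ++ x ∷ B ++ z ∷ C) y (suc (length A)) (suc (length A + suc (length B))) ≡ true
CoverKind⇒coverAtᵇ N A x B z C _ _ (classical refl len)
  rewrite swapPos-transposed A x B z C | eqQ-refl {N} (one N , A ++ z ∷ B ++ x ∷ C)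
        | deg-one N | +-identityʳ (inv (A ++ z ∷ B ++ x ∷ C)) | ≡⇒≡ᵇ≡true len = refl
CoverKind⇒coverAtᵇ N A x B z C _ j≤N (quantum refl len)
  rewrite swapPos-transposed A x B z C
        | eqQ-refl {N} (qq N (suc (length A)) (suc (length A + suc (length B))) , A ++ z ∷ B ++ x ∷ C)
        | deg-qq-transposition N A B j≤N | ≡⇒≡ᵇ≡true len = ∨-zeroʳ _

coverᵇ≡true⇒Cover : ∀ N k u y → length u ≡ N → coverᵇ N k u y ≡ true → Cover N k u y
coverᵇ≡true⇒Cover N k u y len c with coverᵇ≡true⇒coverAtᵇ N k u y c
... | suc t , j , _ , i≤k , k<j , j≤N , at with m≤n⇒∃[o]m+o≡n (≤-trans (s≤s i≤k) k<j)
... | r , refl with splitAt-positions u t r (subst₂ _≤_ (cong suc (sym (+-suc t r))) (sym len) j≤N)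
... | A , x , B , z , C , refl , refl , refl =
  cover A B C x z refl i≤k (subst (k <_) j≡ k<j)
    (coverAtᵇ⇒CoverKind N A x B z C y j≤N′ (subst (λ j → coverAtᵇ N u y (suc (length A)) j ≡ true) j≡ at))
  where
  j≡ : suc (suc (length A) + length B) ≡ suc (length A + suc (length B))
  j≡ = cong suc (sym (+-suc (length A) (length B)))
  j≤N′ = subst (_≤ N) j≡ j≤N

Cover⇒coverᵇ≡true : ∀ N k u y → length u ≡ N → Cover N k u y → coverᵇ N k u y ≡ true
Cover⇒coverᵇ≡true N k u y len (cover A B C x z refl i≤k k<j kind) =
  coverAtᵇ⇒coverᵇ≡true N k (A ++ x ∷ B ++ z ∷ C) y (suc (length A)) (suc (length A + suc (length B)))
    (s≤s z≤n) i≤k k<j j≤N (CoverKind⇒coverAtᵇ N A x B z C y j≤N kind)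
  where
  j≤N = subst (_ ≤_) len (j≤length A x B z C)

NoneBetween : ℕ → ℕ → List ℕ → Set
NoneBetween a b = All (λ c → ¬ (a < c × c < b))

AllBetween : ℕ → ℕ → List ℕ → Set
AllBetween b a = All (λ c → b < c × c < a)

Gap : ℕ → ℕ → List ℕ → Set
Gap a b B = (a < b × NoneBetween a b B) ⊎ (b < a × AllBetween b a B)

-- The combinatorial form of v_ab •_k u = q^β w ≠ 0.
record Step (k a b : ℕ) (u w : List ℕ) : Set where
  constructor step
  field
    A B C : List ℕ
    source : u ≡ A ++ a ∷ B ++ b ∷ C
    target : w ≡ A ++ b ∷ B ++ a ∷ C
    i≤k : suc (length A) ≤ k
    k<j : k < suc (length A + suc (length B))
    gap : Gap a b B

countBetween≡0⇔NoneBetween : ∀ a b B → countBetween a b B ≡ 0 ⇔ NoneBetween a b B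
countBetween≡0⇔NoneBetween a b B = mk⇔
  (λ e → All.map (λ off (a<c , c<b) → true≢false (trans (sym (cong₂ _∧_ (<⇒<ᵇ≡true a<c) (<⇒<ᵇ≡true c<b))) off))
                 (count≡0⇒All-false _ B e))
  (λ none → All-false⇒count≡0 _ B (All.map off none))
  where
  true≢false : true ≢ false
  true≢false ()
  off : ∀ {c} → ¬ (a < c × c < b) → ((a <ᵇ c) ∧ (c <ᵇ b)) ≡ false
  off {c} ¬between with a <ᵇ c in a<c | c <ᵇ b in c<b
  ... | true | true = ⊥-elim (¬between (<ᵇ≡true⇒< a<c , <ᵇ≡true⇒< c<b))
  ... | true | false = refl
  ... | false | _ = refl

countBetween≡length⇔AllBetween : ∀ b a B → countBetween b a B ≡ length B ⇔ AllBetween b a B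
countBetween≡length⇔AllBetween b a B = mk⇔
  (λ e → All.map (λ on → let (b<c , c<a) = ∧≡true⇒× on in <ᵇ≡true⇒< b<c , <ᵇ≡true⇒< c<a)
                 (count≡length⇒All-true _ B e))
  (λ all → All-true⇒count≡length _ B
             (All.map (λ (b<c , c<a) → cong₂ _∧_ (<⇒<ᵇ≡true b<c) (<⇒<ᵇ≡true c<a)) all))

m+[1+2t]≡1+m⇔t≡0 : ∀ m t → m + (1 + 2 * t) ≡ suc m ⇔ t ≡ 0
m+[1+2t]≡1+m⇔t≡0 m t = mk⇔ (to t) (λ { refl → +-comm m 1 })
  where
  to : ∀ t → m + (1 + 2 * t) ≡ suc m → t ≡ 0
  to zero _ = refl
  to (suc t) e = ⊥-elim (m+1+n≢m m (suc-injective (trans (sym (+-suc m (2 * suc t))) e)))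

m+2[1+l]≡1+m+[1+2t]⇔t≡l : ∀ v l t → v + 2 * suc l ≡ suc (v + (1 + 2 * t)) ⇔ t ≡ l
m+2[1+l]≡1+m+[1+2t]⇔t≡l v l t = mk⇔
  (λ e → sym (*-cancelˡ-≡ l t 2 (+-cancelˡ-≡ (2 + v) _ _ (trans (sym (lhs v l)) (trans e (rhs v t))))))
  (λ { refl → trans (lhs v l) (sym (rhs v l)) })
  where
  lhs : ∀ v l → v + 2 * suc l ≡ 2 + v + 2 * l
  lhs = solve-∀
  rhs : ∀ v t → suc (v + (1 + 2 * t)) ≡ 2 + v + 2 * t
  rhs = solve-∀

classical-inv⇔NoneBetween : ∀ A a B b C → a < b → Avoids a b B →
  inv (A ++ b ∷ B ++ a ∷ C) ≡ suc (inv (A ++ a ∷ B ++ b ∷ C)) ⇔ NoneBetween a b B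
classical-inv⇔NoneBetween A a B b C a<b avoids
  rewrite inv-transpose A a B b C a<b avoids =
  Eq.trans (m+[1+2t]≡1+m⇔t≡0 (inv (A ++ a ∷ B ++ b ∷ C)) (countBetween a b B))
           (countBetween≡0⇔NoneBetween a b B)

quantum-inv⇔AllBetween : ∀ A a B b C → b < a → Avoids b a B →
  inv (A ++ b ∷ B ++ a ∷ C) + 2 * suc (length B) ≡ suc (inv (A ++ a ∷ B ++ b ∷ C)) ⇔ AllBetween b a B
quantum-inv⇔AllBetween A a B b C b<a avoids
  rewrite inv-transpose A b B a C b<a avoids =
  Eq.trans (m+2[1+l]≡1+m+[1+2t]⇔t≡l (inv (A ++ b ∷ B ++ a ∷ C)) (length B) (countBetween b a B))
           (countBetween≡length⇔AllBetween b a B)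

inv-sorting-transposition≢1+inv : ∀ A a B b C → a < b → Avoids a b B →
  inv (A ++ a ∷ B ++ b ∷ C) ≢ suc (inv (A ++ b ∷ B ++ a ∷ C))
inv-sorting-transposition≢1+inv A a B b C a<b avoids e =
  m≢1+m+n (inv (A ++ a ∷ B ++ b ∷ C)) (trans e (cong suc (inv-transpose A a B b C a<b avoids)))

Step⇒actGenPerm : ∀ N k a b u w → Unique u → length u ≡ N → Step k a b u w →
  ∃[ β ] actGenPerm N k a b u ≡ just (β , w)
Step⇒actGenPerm N k a b _ _ uniq len (step A B C refl refl i≤k k<j (inj₁ (a<b , none))) =
  one N , trans (if-true (<⇒<ᵇ≡true a<b)) (trans (if-true guard) (cong (λ w → just (one N , w)) swapped))
  where
  u = A ++ a ∷ B ++ b ∷ C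
  d = unique⇒distinctEntries A a B b C uniq
  swapped = swapVal-transposed A a B b C d
  covered : Cover N k u (one N , A ++ b ∷ B ++ a ∷ C)
  covered = cover A B C a b refl i≤k k<j (classical refl
    (Equivalence.from (classical-inv⇔NoneBetween A a B b C a<b (DistinctEntries.avoidsB d)) none))
  guard : coverᵇ N k u (one N , swapVal a b u) ≡ true
  guard = trans (cong (λ w → coverᵇ N k u (one N , w)) swapped) (Cover⇒coverᵇ≡true N k u _ len covered)
Step⇒actGenPerm N k a b _ _ uniq len (step A B C refl refl i≤k k<j (inj₂ (b<a , all))) =
  qq N i j , trans (if-false (≥⇒<ᵇ≡false (<⇒≤ b<a)))
                (trans (if-true (<⇒<ᵇ≡true b<a)) (trans (if-true guard) (cong just y≡)))
  where
  u = A ++ a ∷ B ++ b ∷ C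
  i = suc (length A)
  j = suc (length A + suc (length B))
  d = unique⇒distinctEntries A a B b C uniq
  pa = pos-first A a B b C d
  pb = pos-second A a B b C d
  y≡ : (qq N (pos a u) (pos b u) , swapVal a b u) ≡ (qq N i j , A ++ b ∷ B ++ a ∷ C)
  y≡ = cong₂ _,_ (cong₂ (qq N) pa pb) (swapVal-transposed A a B b C d)
  covered : Cover N k u (qq N i j , A ++ b ∷ B ++ a ∷ C)
  covered = cover A B C a b refl i≤k k<j (quantum refl
    (Equivalence.from (quantum-inv⇔AllBetween A a B b C b<a (Avoids-comm (DistinctEntries.avoidsB d))) all))
  guard : ((pos a u <ᵇ pos b u) ∧ coverᵇ N k u (qq N (pos a u) (pos b u) , swapVal a b u)) ≡ true
  guard = cong₂ _∧_ (trans (cong₂ _<ᵇ_ pa pb) (<⇒<ᵇ≡true (i<j (length A) (length B))))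
                    (trans (cong (coverᵇ N k u) y≡) (Cover⇒coverᵇ≡true N k u _ len covered))

Cover⇒Step-ascent : ∀ N k a b u w → a < b → Unique u → length u ≡ N →
  Cover N k u (one N , w) → w ≡ swapVal a b u → Step k a b u w
Cover⇒Step-ascent N k a b _ _ a<b uniq len (cover A B C x z refl i≤k k<j (quantum e _)) _ =
  ⊥-elim (qq-transposition≢one N A B (subst (_ ≤_) len (j≤length A x B z C)) (sym (cong proj₁ e)))
Cover⇒Step-ascent N k a b _ _ a<b uniq len (cover A B C x z refl i≤k k<j (classical refl inv-cover)) w≡
  with unique⇒distinctEntries A x B z C uniq
... | d with swapVal≡transposed⇒ends a b A x B z C (DistinctEntries.x≢y d) (sym w≡)
...   | inj₁ (refl , refl) = step A B C refl refl i≤k k<j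
  (inj₁ (a<b , Equivalence.to (classical-inv⇔NoneBetween A a B b C a<b (DistinctEntries.avoidsB d)) inv-cover))
...   | inj₂ (refl , refl) =
  ⊥-elim (inv-sorting-transposition≢1+inv A a B b C a<b (Avoids-comm (DistinctEntries.avoidsB d)) inv-cover)

Cover⇒Step-descent : ∀ N k a b u w → b < a → Unique u → length u ≡ N → pos a u < pos b u →
  Cover N k u (qq N (pos a u) (pos b u) , w) → w ≡ swapVal a b u → Step k a b u w
Cover⇒Step-descent N k a b _ w b<a uniq len pa<pb (cover A B C x z refl i≤k k<j kind) w≡
  with unique⇒distinctEntries A x B z C uniq
... | d with swapVal≡transposed⇒ends a b A x B z C (DistinctEntries.x≢y d) (trans (sym w≡) (CoverKind-target kind))
...   | inj₂ (refl , refl) = ⊥-elim (<-asym (i<j (length A) (length B))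
                               (subst₂ _<_ (pos-second A b B a C d) (pos-first A b B a C d) pa<pb))
...   | inj₁ (refl , refl) with kind
...     | classical e _ = ⊥-elim (qq-transposition≢one N A B (subst (_ ≤_) len (j≤length A a B b C))
                            (trans (cong₂ (qq N) (sym (pos-first A a B b C d)) (sym (pos-second A a B b C d)))
                                   (cong proj₁ e)))
...     | quantum e inv-cover = step A B C refl (cong proj₂ e) i≤k k<j (inj₂ (b<a ,
  Equivalence.to (quantum-inv⇔AllBetween A a B b C b<a (Avoids-comm (DistinctEntries.avoidsB d))) inv-cover))

actGenPerm⇒Step : ∀ N k a b u β w → Unique u → length u ≡ N →
  actGenPerm N k a b u ≡ just (β , w) → Step k a b u w
actGenPerm⇒Step N k a b u β w uniq len h with a <ᵇ b in a<b
... | true with coverᵇ N k u (one N , swapVal a b u) in c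
...   | true = Cover⇒Step-ascent N k a b u w (<ᵇ≡true⇒< a<b) uniq len
                 (subst (λ w → Cover N k u (one N , w)) (sym w≡) (coverᵇ≡true⇒Cover N k u _ len c)) w≡
  where
  w≡ : w ≡ swapVal a b u
  w≡ = sym (cong proj₂ (just-injective h))
actGenPerm⇒Step N k a b u β w uniq len h | false with b <ᵇ a in b<a
... | true with pos a u <ᵇ pos b u in pa<pb | coverᵇ N k u (qq N (pos a u) (pos b u) , swapVal a b u) in c
...   | true | true = Cover⇒Step-descent N k a b u w (<ᵇ≡true⇒< b<a) uniq len (<ᵇ≡true⇒< pa<pb)
                        (subst (λ w → Cover N k u (qq N (pos a u) (pos b u) , w)) (sym w≡)
                               (coverᵇ≡true⇒Cover N k u _ len c)) w≡
  where
  w≡ : w ≡ swapVal a b u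
  w≡ = sym (cong proj₂ (just-injective h))

IsPerm⇒Unique : ∀ {N u} → IsPerm N u → Unique u
IsPerm⇒Unique {N} p =
  Unique-resp-↭ (↭⇒↭ₛ (↭-sym p)) (UniqueP.applyUpTo⁺₁ (1 +_) N (λ i<j _ → <⇒≢ (s<s i<j)))

IsPerm⇒length : ∀ {N u} → IsPerm N u → length u ≡ N
IsPerm⇒length {N} p = trans (PermP.↭-length p) (length-applyUpTo (1 +_) N)

Step-preserves-IsPerm : ∀ {N k a b u w} → IsPerm N u → Step k a b u w → IsPerm N w
Step-preserves-IsPerm p (step A B C refl refl _ _ _) = ↭-trans (↭-sym (transpose↭ A _ B _ C)) p

actGen≡just⇒ : ∀ N k a b x β w → actGen N k (a , b) x ≡ just (β , w) →
  ∃[ α ] ∃[ u ] ∃[ β₁ ] (x ≡ just (α , u) × actGenPerm N k a b u ≡ just (β₁ , w))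
actGen≡just⇒ N k a b (just (α , u)) β w h with actGenPerm N k a b u in e
actGen≡just⇒ N k a b (just (α , u)) β w refl | just (β₁ , w₁) = α , u , β₁ , refl , e

actGen-just : ∀ N k a b α u β w → actGenPerm N k a b u ≡ just (β , w) →
  actGen N k (a , b) (just (α , u)) ≡ just (α · β , w)
actGen-just N k a b α u β w e rewrite e = refl

coverᵇ≡true⇒level-bounds : ∀ N k u y → coverᵇ N k u y ≡ true → 1 ≤ k × k < N
coverᵇ≡true⇒level-bounds N k u y c with coverᵇ≡true⇒coverAtᵇ N k u y c
... | _ , _ , 1≤i , i≤k , k<j , j≤N , _ = ≤-trans 1≤i i≤k , <-≤-trans k<j j≤N

actGenPerm≡just⇒level-bounds : ∀ N k a b u β w → actGenPerm N k a b u ≡ just (β , w) →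
  1 ≤ k × k < N
actGenPerm≡just⇒level-bounds N k a b u β w h with a <ᵇ b
... | true with coverᵇ N k u (one N , swapVal a b u) in c
...   | true = coverᵇ≡true⇒level-bounds N k u (one N , swapVal a b u) c
actGenPerm≡just⇒level-bounds N k a b u β w h | false with b <ᵇ a
... | true with pos a u <ᵇ pos b u | coverᵇ N k u (qq N (pos a u) (pos b u) , swapVal a b u) in c
...   | true | true = coverᵇ≡true⇒level-bounds N k u (qq N (pos a u) (pos b u) , swapVal a b u) c

act≡just⇒level-bounds : ∀ N k v x β w → v ≢ [] → act N k v x ≡ just (β , w) → 1 ≤ k × k < N
act≡just⇒level-bounds N k [] x β w v≢[] _ = ⊥-elim (v≢[] refl)
act≡just⇒level-bounds N k ((a , b) ∷ v) x β w _ h with actGen≡just⇒ N k a b (act N k v x) β w h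
... | _ , u , β₁ , _ , e = actGenPerm≡just⇒level-bounds N k a b u β₁ w e

act-simulation : ∀ {N N′ k k′} (Inv : List ℕ → Set) (F : List ℕ → List ℕ)
  (Sim : ℕ × ℕ → ℕ × ℕ → Set) →
  (∀ {a b a′ b′ u β w} → Sim (a , b) (a′ , b′) → Inv u → actGenPerm N k a b u ≡ just (β , w) →
    Inv w × ∃[ β′ ] actGenPerm N′ k′ a′ b′ (F u) ≡ just (β′ , F w)) →
  ∀ {v v′} → Pointwise Sim v v′ → ∀ α α′ {u β w} → Inv u → act N k v (just (α , u)) ≡ just (β , w) →
  Inv w × ∃[ γ ] act N′ k′ v′ (just (α′ , F u)) ≡ just (γ , F w)
act-simulation Inv F Sim sim [] α α′ inv refl = inv , α′ , refl
act-simulation {N} {N′} {k} {k′} Inv F Sim sim {(a , b) ∷ v} {(a′ , b′) ∷ v′} (s ∷ ss) α α′ {u} inv h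
  with actGen≡just⇒ N k a b (act N k v (just (α , u))) _ _ h
... | _ , w₀ , _ , e₀ , e₁ with act-simulation Inv F Sim sim ss α α′ inv e₀
...   | inv₀ , γ , e₀′ with sim s inv₀ e₁
...     | inv₁ , β′ , e₁′ =
  inv₁ , γ · β′ , trans (cong (actGen N′ k′ (a′ , b′)) e₀′) (actGen-just N′ k′ a′ b′ γ (F w₀) β′ _ e₁′)

memberᵇ : List ℕ → ℕ → Bool
memberᵇ [] x = false
memberᵇ (s ∷ S) x = (s ≡ᵇ x) ∨ memberᵇ S x

memberᵇ≡true⇒∈ : ∀ S x → memberᵇ S x ≡ true → x ∈ S
memberᵇ≡true⇒∈ (s ∷ S) x e with s ≡ᵇ x in s≡x
... | true = here (sym (≡ᵇ≡true⇒≡ s≡x))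
... | false = there (memberᵇ≡true⇒∈ S x e)

∈⇒memberᵇ≡true : ∀ S x → x ∈ S → memberᵇ S x ≡ true
∈⇒memberᵇ≡true (s ∷ S) x (here refl) rewrite ≡⇒≡ᵇ≡true {x} refl = refl
∈⇒memberᵇ≡true (s ∷ S) x (there x∈S) rewrite ∈⇒memberᵇ≡true S x x∈S = ∨-zeroʳ (s ≡ᵇ x)

count-≡ᵇ : ∀ S y → Unique S → count (_≡ᵇ y) S ≡ indicator (memberᵇ S y)
count-≡ᵇ [] y _ = refl
count-≡ᵇ (s ∷ S) y (s≢S ∷ unique) with s ≡ᵇ y in s≡y
... | true = cong suc (All-false⇒count≡0 _ S
    (All.map (λ s≢c → ≢⇒≡ᵇ≡false (λ c≡y → s≢c (trans (≡ᵇ≡true⇒≡ s≡y) (sym c≡y)))) s≢S))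
... | false = count-≡ᵇ S y unique

indicator-<ᵇ-suc : ∀ x y → indicator (x <ᵇ suc y) ≡ indicator (x <ᵇ y) + indicator (x ≡ᵇ y)
indicator-<ᵇ-suc x y with <-cmp x y
... | tri< x<y _ _ rewrite <⇒<ᵇ≡true x<y | <⇒<ᵇ≡true (m<n⇒m<1+n x<y) | ≢⇒≡ᵇ≡false (<⇒≢ x<y) = refl
... | tri≈ _ refl _ rewrite <⇒<ᵇ≡true (n<1+n x) | ≥⇒<ᵇ≡false {x} {x} ≤-refl | ≡⇒≡ᵇ≡true {x} refl = refl
... | tri> _ _ y<x rewrite ≥⇒<ᵇ≡false y<x | ≥⇒<ᵇ≡false (<⇒≤ y<x)
                        | ≢⇒≡ᵇ≡false (≢-sym (<⇒≢ y<x)) = refl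

countLess-suc : ∀ y xs → countLess (suc y) xs ≡ countLess y xs + count (_≡ᵇ y) xs
countLess-suc y [] = refl
countLess-suc y (x ∷ xs)
  rewrite count-∷ (_<ᵇ suc y) x xs | count-∷ (_<ᵇ y) x xs | count-∷ (_≡ᵇ y) x xs
        | indicator-<ᵇ-suc x y | countLess-suc y xs
  = regroup (indicator (x <ᵇ y)) (indicator (x ≡ᵇ y)) (countLess y xs) (count (_≡ᵇ y) xs)
  where
  regroup : ∀ a b c d → a + b + (c + d) ≡ a + c + (b + d)
  regroup = solve-∀

φ-mono-≤ : ∀ S {x y} → x ≤ y → φ S x ≤ φ S y
φ-mono-≤ S x≤y = s≤s (count-mono _ _ S (λ c c<x → <⇒<ᵇ≡true (<-≤-trans (<ᵇ≡true⇒< c<x) x≤y)))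

φ-mono-< : ∀ S {s x} → s ∈ S → s < x → φ S s < φ S x
φ-mono-< S {s} {x} s∈S s<x = s≤s (count-mono-< (_<ᵇ s) (_<ᵇ x) S s
  (λ c c<s → <⇒<ᵇ≡true (<-trans (<ᵇ≡true⇒< c<s) s<x)) s∈S (≥⇒<ᵇ≡false {s} ≤-refl) (<⇒<ᵇ≡true s<x))

φ-cancel-< : ∀ S {x y} → φ S x < φ S y → x < y
φ-cancel-< S {x} {y} φx<φy with <-cmp x y
... | tri< x<y _ _ = x<y
... | tri≈ _ refl _ = ⊥-elim (<-irrefl refl φx<φy)
... | tri> _ _ y<x = ⊥-elim (<⇒≱ φx<φy (φ-mono-≤ S (<⇒≤ y<x)))

fromTo-suc : ∀ n → fromTo 1 (suc n) ≡ fromTo 1 n ++ suc n ∷ []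
fromTo-suc n = sym (applyUpTo-∷ʳ suc n)

take-transposed : ∀ (A : List ℕ) a R q → take (suc (length A + q)) (A ++ a ∷ R) ≡ A ++ a ∷ take q R
take-transposed [] a R q = refl
take-transposed (c ∷ A) a R q = cong (c ∷_) (take-transposed A a R q)

take-++ˡ : ∀ (B : List ℕ) R q → q ≤ length B → take q (B ++ R) ≡ take q B
take-++ˡ B R zero _ = refl
take-++ˡ (c ∷ B) R (suc q) (s≤s q≤B) = cong (c ∷_) (take-++ˡ B R q q≤B)

filter-not++filter↭ : ∀ (p : ℕ → Bool) xs → xs ↭ filterᵇ (not ∘ p) xs ++ filterᵇ p xs
filter-not++filter↭ p [] = ↭-refl
filter-not++filter↭ p (x ∷ xs) with p x
... | true = ↭-trans (prep x (filter-not++filter↭ p xs))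
                    (↭-sym (PermP.shift x (filterᵇ (not ∘ p) xs) (filterᵇ p xs)))
... | false = prep x (filter-not++filter↭ p xs)

module Flattening (S : List ℕ) (S-unique : Unique S) (S-positive : All (1 ≤_) S) where

  inS : ℕ → Bool
  inS = memberᵇ S

  countLess-suc≡count-inS : ∀ x → countLess (suc x) S ≡ count inS (fromTo 1 x)
  countLess-suc≡count-inS zero = All-false⇒count≡0 _ S (All.map ≥⇒<ᵇ≡false S-positive)
  countLess-suc≡count-inS (suc x) = begin
      countLess (2 + x) S
    ≡⟨ countLess-suc (suc x) S ⟩
      countLess (suc x) S + count (_≡ᵇ suc x) S
    ≡⟨ cong₂ _+_ (countLess-suc≡count-inS x) (count-≡ᵇ S (suc x) S-unique) ⟩
      count inS (fromTo 1 x) + indicator (inS (suc x))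
    ≡⟨ cong (count inS (fromTo 1 x) +_) (sym (trans (count-∷ inS (suc x) []) (+-identityʳ _))) ⟩
      count inS (fromTo 1 x) + count inS (suc x ∷ [])
    ≡⟨ sym (count-++ inS (fromTo 1 x) (suc x ∷ [])) ⟩
      count inS (fromTo 1 x ++ suc x ∷ [])
    ≡⟨ cong (count inS) (sym (fromTo-suc x)) ⟩
      count inS (fromTo 1 (suc x))
    ∎
    where open ≡-Reasoning

  sortedUpTo : ℕ → List ℕ
  sortedUpTo n = filterᵇ inS (fromTo 1 n)

  sortedUpTo-suc : ∀ n → sortedUpTo (suc n) ≡ sortedUpTo n ++ filterᵇ inS (suc n ∷ [])
  sortedUpTo-suc n =
    trans (cong (filterᵇ inS) (fromTo-suc n)) (filter-++ (T? ∘ inS) (fromTo 1 n) (suc n ∷ []))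

  map-φ-sortedUpTo : ∀ n → map (φ S) (sortedUpTo n) ≡ fromTo 1 (length (sortedUpTo n))
  map-φ-sortedUpTo zero = refl
  map-φ-sortedUpTo (suc n) rewrite sortedUpTo-suc n with inS (suc n)
  ... | false rewrite ++-identityʳ (sortedUpTo n) = map-φ-sortedUpTo n
  ... | true rewrite map-++ (φ S) (sortedUpTo n) (suc n ∷ []) | map-φ-sortedUpTo n
                   | countLess-suc≡count-inS n | length-++ (sortedUpTo n) {suc n ∷ []}
                   | +-comm (length (sortedUpTo n)) 1
    = sym (fromTo-suc (length (sortedUpTo n)))

  length-sortedUpTo : ∀ N → All (_≤ N) S → length (sortedUpTo N) ≡ length S
  length-sortedUpTo N S≤N =
    trans (sym (countLess-suc≡count-inS N))
          (All-true⇒count≡length _ S (All.map (λ s≤N → <⇒<ᵇ≡true (s≤s s≤N)) S≤N))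

  restrict : List ℕ → List ℕ
  restrict x = map (φ S) (filterᵇ inS x)

  -- Restriction moves the level k to the number of support values among u(1), …, u(k).
  level : ℕ → List ℕ → ℕ
  level k x = count inS (take k x)

  restrict-transposed : ∀ A a B b C → inS a ≡ true → inS b ≡ true →
    restrict (A ++ a ∷ B ++ b ∷ C) ≡ restrict A ++ φ S a ∷ restrict B ++ φ S b ∷ restrict C
  restrict-transposed A a B b C a∈S b∈S
    rewrite filter-++ (T? ∘ inS) A (a ∷ B ++ b ∷ C) | a∈S | filter-++ (T? ∘ inS) B (b ∷ C) | b∈S
          | map-++ (φ S) (filterᵇ inS A) (a ∷ filterᵇ inS B ++ b ∷ filterᵇ inS C)
          | map-++ (φ S) (filterᵇ inS B) (b ∷ filterᵇ inS C) = refl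

  level-transposed : ∀ A a B b C q → inS a ≡ true → q ≤ length B →
    level (suc (length A + q)) (A ++ a ∷ B ++ b ∷ C) ≡ count inS A + suc (count inS (take q B))
  level-transposed A a B b C q a∈S q≤B
    rewrite take-transposed A a (B ++ b ∷ C) q | take-++ˡ B (b ∷ C) q q≤B
          | count-++ inS A (a ∷ take q B) | count-∷ inS a (take q B) | a∈S = refl

  Gap-restrict : ∀ a b B → inS a ≡ true → inS b ≡ true → Gap a b B → Gap (φ S a) (φ S b) (restrict B)
  Gap-restrict a b B a∈S b∈S (inj₁ (a<b , none)) =
    inj₁ (φ-mono-< S (memberᵇ≡true⇒∈ S a a∈S) a<b ,
          AllP.map⁺ (AllP.filter⁺ (T? ∘ inS)
            (All.map (λ ¬between (φa<φc , φc<φb) → ¬between (φ-cancel-< S φa<φc , φ-cancel-< S φc<φb)) none)))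
  Gap-restrict a b B a∈S b∈S (inj₂ (b<a , all)) =
    inj₂ (φ-mono-< S (memberᵇ≡true⇒∈ S b b∈S) b<a ,
          AllP.map⁺ (All.zipWith (λ ((b<c , c<a) , c∈S) → φ-mono-< S (memberᵇ≡true⇒∈ S b b∈S) b<c ,
                                                            φ-mono-< S (memberᵇ≡true⇒∈ S _ (Equivalence.to T-≡ c∈S)) c<a)
                                 (AllP.filter⁺ (T? ∘ inS) all , AllP.all-filter (T? ∘ inS) B)))

  restrict-Step : ∀ k a b x y → inS a ≡ true → inS b ≡ true → Step k a b x y →
    Step (level k x) (φ S a) (φ S b) (restrict x) (restrict y) × level k y ≡ level k x
  restrict-Step _ a b _ _ a∈S b∈S (step A B C refl refl i≤k k<j gap) with m≤n⇒∃[o]m+o≡n i≤k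
  ... | q , refl =
    step (restrict A) (restrict B) (restrict C) (restrict-transposed A a B b C a∈S b∈S)
         (restrict-transposed A b B a C b∈S a∈S) i≤level level<j (Gap-restrict a b B a∈S b∈S gap) ,
    trans (level-transposed A b B a C q b∈S q≤B) (sym (level-transposed A a B b C q a∈S q≤B))
    where
    q≤B : q ≤ length B
    q≤B = s≤s⁻¹ (+-cancelˡ-< (length A) q (suc (length B)) (s≤s⁻¹ k<j))
    i≤level : suc (length (restrict A)) ≤ level (suc (length A + q)) (A ++ a ∷ B ++ b ∷ C)
    i≤level rewrite level-transposed A a B b C q a∈S q≤B | length-map (φ S) (filterᵇ inS A) =
      subst (suc (count inS A) ≤_) (sym (+-suc (count inS A) _)) (s≤s (m≤m+n _ _))
    level<j : level (suc (length A + q)) (A ++ a ∷ B ++ b ∷ C)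
            < suc (length (restrict A) + suc (length (restrict B)))
    level<j rewrite level-transposed A a B b C q a∈S q≤B | length-map (φ S) (filterᵇ inS A)
                  | length-map (φ S) (filterᵇ inS B) =
      s≤s (+-monoʳ-≤ (count inS A) (s≤s (count-take≤ inS B q)))

  Flattens : ℕ × ℕ → ℕ × ℕ → Set
  Flattens (a , b) (a′ , b′) = inS a ≡ true × inS b ≡ true × a′ ≡ φ S a × b′ ≡ φ S b

  Pointwise-Flattens : ∀ v → (∀ {x} → x ∈ supp v → inS x ≡ true) →
    Pointwise Flattens v (map (λ p → φ S (proj₁ p) , φ S (proj₂ p)) v)
  Pointwise-Flattens [] _ = []
  Pointwise-Flattens ((a , b) ∷ v) supported =
    (supported (here refl) , supported (there (here refl)) , refl , refl)
      ∷ Pointwise-Flattens v (supported ∘ there ∘ there)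

  m : ℕ
  m = length S

  module Bounded (N : ℕ) (S≤N : All (_≤ N) S) where

    sorted : List ℕ
    sorted = sortedUpTo N

    length-sorted : length sorted ≡ m
    length-sorted = length-sortedUpTo N S≤N

    unrank : ℕ → ℕ
    unrank = nth sorted

    φ-unrank : ∀ t → t < m → φ S (unrank (suc t)) ≡ suc t
    φ-unrank t t<m = begin
        φ S (nth sorted (suc t))
      ≡⟨ nth-map (φ S) sorted t t<|sorted| ⟨
        nth (map (φ S) sorted) (suc t)
      ≡⟨ cong (λ xs → nth xs (suc t)) (map-φ-sortedUpTo N) ⟩
        nth (fromTo 1 (length sorted)) (suc t)
      ≡⟨ nth-applyUpTo (1 +_) (length sorted) t t<|sorted| ⟩
        suc t
      ∎
      where
      open ≡-Reasoning
      t<|sorted| = subst (t <_) (sym length-sorted) t<m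

    unrank-inS : ∀ t → t < m → inS (unrank (suc t)) ≡ true
    unrank-inS t t<m =
      Equivalence.to T-≡ (proj₂ (∈-filter⁻ (T? ∘ inS) {xs = fromTo 1 N}
                                           (nth-∈ sorted t (subst (t <_) (sym length-sorted) t<m))))

    unrank-φ : ∀ a → inS a ≡ true → unrank (φ S a) ≡ a
    unrank-φ zero a∈S = ⊥-elim (1+n≰n (All.lookup S-positive (memberᵇ≡true⇒∈ S 0 a∈S)))
    unrank-φ (suc a) a∈S
      with ∈⇒nth sorted (∈-filter⁺ (T? ∘ inS) (∈-applyUpTo⁺ (1 +_) a<N) (Equivalence.from T-≡ a∈S))
      where
      a<N : a < N
      a<N = All.lookup S≤N (memberᵇ≡true⇒∈ S (suc a) a∈S)
    ... | t , t<|sorted| , unrank-t≡a = trans (cong unrank φa≡1+t) unrank-t≡a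
      where
      φa≡1+t = trans (cong (φ S) (sym unrank-t≡a)) (φ-unrank t (subst (t <_) length-sorted t<|sorted|))

    restrict-IsPerm : ∀ x → IsPerm N x → IsPerm m (restrict x)
    restrict-IsPerm x p = subst (restrict x ↭_) (trans (map-φ-sortedUpTo N) (cong (fromTo 1) length-sorted))
      (PermP.map⁺ (φ S) (PermP.filter-↭ (T? ∘ inS) p))

    padding : List ℕ
    padding = filterᵇ (not ∘ inS) (fromTo 1 N)

    -- The values outside S come first, so none of them lies between two entries a generator exchanges.
    embed : List ℕ → List ℕ
    embed y = padding ++ map unrank y

    embed-IsPerm : ∀ y → IsPerm m y → IsPerm N (embed y)
    embed-IsPerm y p =
      ↭-trans (PermP.++⁺ˡ padding (↭-trans (PermP.map⁺ unrank p) (↭-reflexive map-unrank-fromTo)))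
              (↭-sym (filter-not++filter↭ inS (fromTo 1 N)))
      where
      map-unrank-fromTo : map unrank (fromTo 1 m) ≡ sorted
      map-unrank-fromTo =
        trans (cong (λ n → map unrank (fromTo 1 n)) (sym length-sorted)) (map-nth-fromTo sorted)

    length-padding : length padding + m ≡ N
    length-padding = begin
        length padding + m
      ≡⟨ cong (length padding +_) length-sorted ⟨
        length padding + length sorted
      ≡⟨ length-++ padding ⟨
        length (padding ++ sorted)
      ≡⟨ PermP.↭-length (filter-not++filter↭ inS (fromTo 1 N)) ⟨
        length (fromTo 1 N)
      ≡⟨ length-applyUpTo (1 +_) N ⟩
        N
      ∎
      where open ≡-Reasoning

    embed-transposed : ∀ a b A B C → inS a ≡ true → inS b ≡ true →
      embed (A ++ φ S a ∷ B ++ φ S b ∷ C) ≡ (padding ++ map unrank A) ++ a ∷ map unrank B ++ b ∷ map unrank C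
    embed-transposed a b A B C a∈S b∈S
      rewrite map-++ unrank A (φ S a ∷ B ++ φ S b ∷ C) | map-++ unrank B (φ S b ∷ C)
            | unrank-φ a a∈S | unrank-φ b b∈S
      = sym (++-assoc padding (map unrank A) _)

    unrank-inRange : ∀ {c} → InRange m c → φ S (unrank c) ≡ c × inS (unrank c) ≡ true
    unrank-inRange {suc t} (_ , t<m) = φ-unrank t t<m , unrank-inS t t<m

    Gap-embed : ∀ a b B → inS a ≡ true → inS b ≡ true → All (InRange m) B →
      Gap (φ S a) (φ S b) B → Gap a b (map unrank B)
    Gap-embed a b B a∈S b∈S B-range (inj₁ (φa<φb , none)) =
      inj₁ (φ-cancel-< S φa<φb , AllP.map⁺ (All.zipWith outside (B-range , none)))
      where
      outside : ∀ {c} → InRange m c × ¬ (φ S a < c × c < φ S b) → ¬ (a < unrank c × unrank c < b)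
      outside {c} (c-range , ¬between) (a<c , c<b) with unrank-inRange c-range
      ... | φc≡c , c∈S = ¬between (subst (φ S a <_) φc≡c (φ-mono-< S (memberᵇ≡true⇒∈ S a a∈S) a<c) ,
                                   subst (_< φ S b) φc≡c (φ-mono-< S (memberᵇ≡true⇒∈ S _ c∈S) c<b))
    Gap-embed a b B a∈S b∈S B-range (inj₂ (φb<φa , all)) =
      inj₂ (φ-cancel-< S φb<φa , AllP.map⁺ (All.zipWith inside (B-range , all)))
      where
      inside : ∀ {c} → InRange m c × (φ S b < c × c < φ S a) → b < unrank c × unrank c < a
      inside {c} (c-range , (φb<c , c<φa)) with unrank-inRange c-range
      ... | φc≡c , _ =
        φ-cancel-< S (subst (φ S b <_) (sym φc≡c) φb<c) , φ-cancel-< S (subst (_< φ S a) (sym φc≡c) c<φa)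

    embed-Step : ∀ k a b x y → inS a ≡ true → inS b ≡ true → All (InRange m) x →
      Step k (φ S a) (φ S b) x y → Step (length padding + k) a b (embed x) (embed y)
    embed-Step k a b _ _ a∈S b∈S x-range (step A B C refl refl i≤k k<j gap) =
      step (padding ++ map unrank A) (map unrank B) (map unrank C)
        (embed-transposed a b A B C a∈S b∈S) (embed-transposed b a A B C b∈S a∈S) i≤k′ k<j′
        (Gap-embed a b B a∈S b∈S (proj₁ (AllP.++⁻ B (All.tail (proj₂ (AllP.++⁻ A x-range))))) gap)
      where
      i≤k′ : suc (length (padding ++ map unrank A)) ≤ length padding + k
      i≤k′ rewrite length-++ padding {map unrank A} | length-map unrank A =
        subst (_≤ length padding + k) (+-suc (length padding) (length A)) (+-monoʳ-≤ (length padding) i≤k)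
      k<j′ : length padding + k < suc (length (padding ++ map unrank A) + suc (length (map unrank B)))
      k<j′ rewrite length-++ padding {map unrank A} | length-map unrank A | length-map unrank B =
        subst (length padding + k <_)
          (trans (+-suc (length padding) _) (cong suc (sym (+-assoc (length padding) (length A) _))))
          (+-monoʳ-< (length padding) k<j)

    restrict-simulation : ∀ k ℓ {a b a′ b′ u β w} → Flattens (a , b) (a′ , b′) →
      IsPerm N u × level k u ≡ ℓ →
      actGenPerm N k a b u ≡ just (β , w) →
      (IsPerm N w × level k w ≡ ℓ) × ∃[ β′ ] actGenPerm m ℓ a′ b′ (restrict u) ≡ just (β′ , restrict w)
    restrict-simulation k _ {a} {b} {u = u} {β} {w} (a∈S , b∈S , refl , refl) (u-perm , refl) h =
      (Step-preserves-IsPerm u-perm uw , proj₂ restricted) ,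
      Step⇒actGenPerm m (level k u) (φ S a) (φ S b) (restrict u) (restrict w)
        (IsPerm⇒Unique ru-perm) (IsPerm⇒length ru-perm) (proj₁ restricted)
      where
      uw = actGenPerm⇒Step N k a b u β w (IsPerm⇒Unique u-perm) (IsPerm⇒length u-perm) h
      restricted = restrict-Step k a b u w a∈S b∈S uw
      ru-perm = restrict-IsPerm u u-perm

    embed-simulation : ∀ k {c d a b u β w} → Flattens (a , b) (c , d) → IsPerm m u →
      actGenPerm m k c d u ≡ just (β , w) →
      IsPerm m w × ∃[ β′ ] actGenPerm N (length padding + k) a b (embed u) ≡ just (β′ , embed w)
    embed-simulation k {a = a} {b} {u} {β} {w} (a∈S , b∈S , refl , refl) u-perm h =
      Step-preserves-IsPerm u-perm uw ,
      Step⇒actGenPerm N (length padding + k) a b (embed u) (embed w)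
        (IsPerm⇒Unique eu-perm) (IsPerm⇒length eu-perm)
        (embed-Step k a b u w a∈S b∈S (PermP.All-resp-↭ (↭-sym u-perm) fromTo-inRange) uw)
      where
      uw = actGenPerm⇒Step m k (φ S a) (φ S b) u β w (IsPerm⇒Unique u-perm) (IsPerm⇒length u-perm) h
      eu-perm = embed-IsPerm u u-perm
      fromTo-inRange : All (InRange m) (fromTo 1 m)
      fromTo-inRange = AllP.applyUpTo⁺₁ (1 +_) m (λ t<m → s≤s z≤n , t<m)

  zero-by-restriction : ∀ {v v′} → Pointwise Flattens v v′ → v′ ≢ [] → ∀ N → All (_≤ N) S →
    (∀ u → IsPerm m u → ∀ k → 1 ≤ k → k < m → act m k v′ (just (one m , u)) ≡ nothing) →
    ∀ α u → IsPerm N u → ∀ k → act N k v (just (α , u)) ≡ nothing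
  zero-by-restriction {v} {v′} flattens v′≢[] N S≤N flattened-zero α u u-perm k
    with act N k v (just (α , u)) in e
  ... | nothing = refl
  ... | just _ = ⊥-elim (just≢nothing (trans (sym restricted)
          (flattened-zero (restrict u) (restrict-IsPerm u u-perm) (level k u) (proj₁ bounds) (proj₂ bounds))))
    where
    open Bounded N S≤N
    restricted = proj₂ (proj₂ (act-simulation (λ x → IsPerm N x × level k x ≡ level k u) restrict Flattens
                                              (restrict-simulation k (level k u)) flattens α (one m) (u-perm , refl) e))
    bounds = act≡just⇒level-bounds m (level k u) v′ _ _ _ v′≢[] restricted

  zero-by-embedding : ∀ {v v′} → Pointwise Flattens v v′ → ∀ N → All (_≤ N) S →
    (∀ u → IsPerm N u → ∀ k → 1 ≤ k → k < N → act N k v (just (one N , u)) ≡ nothing) →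
    ∀ u → IsPerm m u → ∀ k → 1 ≤ k → k < m → act m k v′ (just (one m , u)) ≡ nothing
  zero-by-embedding {v} {v′} flattens N S≤N vanishes u u-perm k 1≤k k<m
    with act m k v′ (just (one m , u)) in e
  ... | nothing = refl
  ... | just _ = ⊥-elim (just≢nothing (trans (sym embedded)
          (vanishes (embed u) (embed-IsPerm u u-perm) (length padding + k) (≤-trans 1≤k (m≤n+m k _))
                    (subst (length padding + k <_) length-padding (+-monoʳ-< (length padding) k<m)))))
    where
    open Bounded N S≤N
    embedded = proj₂ (proj₂ (act-simulation (IsPerm m) embed (λ p q → Flattens q p) (embed-simulation k)
                                            (PointwiseP.symmetric id flattens) (one m) (one N) u-perm e))

deduplicateᵇ-unique : ∀ xs → Unique (deduplicateᵇ _≡ᵇ_ xs)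
deduplicateᵇ-unique [] = []
deduplicateᵇ-unique (x ∷ xs) =
  All.map (λ x≢ᵇy x≡y → x≢ᵇy (≡⇒≡ᵇ x _ x≡y)) (AllP.all-filter _ (deduplicateᵇ _≡ᵇ_ xs))
    ∷ UniqueP.filter⁺ _ (deduplicateᵇ-unique xs)

∈-deduplicateᵇ : ∀ {x xs} → x ∈ xs → x ∈ deduplicateᵇ _≡ᵇ_ xs
∈-deduplicateᵇ = AnyP.deduplicate⁺ _ (λ y≡ᵇx z≡x → trans z≡x (sym (≡ᵇ⇒≡ _ _ y≡ᵇx)))

supp-positive : ∀ v → All ValidGen v → All (1 ≤_) (supp v)
supp-positive [] [] = []
supp-positive ((a , b) ∷ v) (valid 1≤a 1≤b _ ∷ valids) = 1≤a ∷ 1≤b ∷ supp-positive v valids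

map-≢[] : ∀ {A B : Set} (f : A → B) xs → xs ≢ [] → map f xs ≢ []
map-≢[] f [] xs≢[] = ⊥-elim (xs≢[] refl)
map-≢[] f (x ∷ xs) _ ()

proposition5p16 : (v : Word) → All ValidGen v → v ≢ [] →
    IsZeroOp v ⇔
      ((u : List ℕ) → IsPerm (length (suppSet v)) u →
       (k : ℕ) → 1 ≤ k → k < length (suppSet v) →
       act (length (suppSet v)) k (flatten v) (just (one (length (suppSet v)) , u)) ≡ nothing)
proposition5p16 v valids v≢[] =
  mk⇔ (λ vanishes → zero-by-embedding flattens N₀ S≤N₀ (vanishes N₀ supp-inRange (one N₀)))
      (λ flattened-zero N supp-inRange α u u-perm k _ _ →
         zero-by-restriction flattens (map-≢[] _ v v≢[]) N
           (AllP.deduplicate⁺ _ (All.map proj₂ supp-inRange)) flattened-zero α u u-perm k)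
  where
  S = suppSet v
  open Flattening S (deduplicateᵇ-unique (supp v)) (AllP.deduplicate⁺ _ (supp-positive v valids))

  flattens : Pointwise Flattens v (flatten v)
  flattens = Pointwise-Flattens v (λ x∈supp → ∈⇒memberᵇ≡true S _ (∈-deduplicateᵇ x∈supp))

  N₀ = max 0 (supp v)
  S≤N₀ = AllP.deduplicate⁺ _ (xs≤max 0 (supp v))
  supp-inRange : All (InRange N₀) (supp v)
  supp-inRange = All.zip (supp-positive v valids , xs≤max 0 (supp v))
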